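{- For every positive integer $m$, \[ \sum_{\alpha=1}^{m-1}(-1)^{m+\alpha+1}\binom{m}{\alpha+1}\alpha^m=m!-1. \] -}

module Defs where

open import Data.Nat using (ℕ; zero; suc)
open import Data.Integer using (ℤ; -_; _+_; _*_; +_)

sign : ℕ → ℤ
sign zero = + 1
sign (suc k) = - sign k

sumCount : ℕ → ℕ → (ℕ → ℤ) → ℤ
sumCount a zero f = + 0
sumCount a (suc n) f = f a + sumCount (suc a) n f

{-# OPTIONS --safe #-}
-- Write Δᵏ f for the k-th forward difference of f at 0. The discrete Leibniz rule
-- Δᵏ⁺¹ ((x + j) g) = x Δᵏ⁺¹ g + (k + 1) Δᵏ (g ∘ suc) shows by induction on n that
-- Δᵏ (x + j)ⁿ vanishes for n < k and equals n! for k = n. On the other hand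
-- Δᵐ f = Σⱼ (-1)ᵐ⁺ʲ C(m, j) f j by Pascal's rule. For f j = (j - 1)ᵐ the terms j = 0
-- and j = 1 of this sum are 1 and 0, and the term j = α + 1 is the α-th summand of
-- the proposition.
module Submission where

open import Defs
open import Data.Nat using (ℕ; zero; suc; _∸_; _^_; _!; _<_; s≤s; z≤n) renaming (_+_ to _+ℕ_)
import Data.Nat.Properties as ℕ
open import Data.Nat.Combinatorics using (_C_; nCk+nC[k+1]≡[n+1]C[k+1]; nCk≡nC[n∸k]; nCn≡1)
open import Data.Integer using (ℤ; +_; -_; _+_; _*_; _-_; 0ℤ; 1ℤ; -1ℤ) renaming (_^_ to _^ℤ_)
import Data.Integer.Properties as ℤ
open import Data.Integer.Tactic.RingSolver using (solve-∀)
open import Function using (_∘_)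
open import Relation.Binary.PropositionalEquality
  using (_≡_; refl; sym; trans; cong; cong₂; module ≡-Reasoning)

sumCount-ext : ∀ a n {f g : ℕ → ℤ} → (∀ j → f j ≡ g j) → sumCount a n f ≡ sumCount a n g
sumCount-ext a zero    f≡g = refl
sumCount-ext a (suc n) f≡g = cong₂ _+_ (f≡g a) (sumCount-ext (suc a) n f≡g)

sumCount-shift : ∀ a n (f : ℕ → ℤ) → sumCount (suc a) n f ≡ sumCount a n (f ∘ suc)
sumCount-shift a zero    f = refl
sumCount-shift a (suc n) f = cong (_+_ (f (suc a))) (sumCount-shift (suc a) n f)

sumCount-zero : ∀ a n → sumCount a n (λ _ → 0ℤ) ≡ 0ℤ
sumCount-zero a zero    = refl
sumCount-zero a (suc n) = cong (_+_ 0ℤ) (sumCount-zero (suc a) n)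

sumCount-sub : ∀ a n (f g : ℕ → ℤ) →
               sumCount a n (λ j → f j - g j) ≡ sumCount a n f - sumCount a n g
sumCount-sub a zero    f g = refl
sumCount-sub a (suc n) f g =
  trans (cong (_+_ (f a - g a)) (sumCount-sub (suc a) n f g))
        (regroup (f a) (g a) (sumCount (suc a) n f) (sumCount (suc a) n g))
  where
  regroup : ∀ x y s t → (x - y) + (s - t) ≡ (x + s) - (y + t)
  regroup = solve-∀

Δ : ℕ → (ℕ → ℤ) → ℤ
Δ zero    f = f 0
Δ (suc k) f = Δ k (f ∘ suc) - Δ k f

Δ-ext : ∀ k {f g : ℕ → ℤ} → (∀ j → f j ≡ g j) → Δ k f ≡ Δ k g
Δ-ext zero    f≡g = f≡g 0
Δ-ext (suc k) f≡g = cong₂ _-_ (Δ-ext k (f≡g ∘ suc)) (Δ-ext k f≡g)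

Δ-const : ∀ k c → Δ (suc k) (λ _ → c) ≡ 0ℤ
Δ-const k c = ℤ.+-inverseʳ (Δ k (λ _ → c))

nC0≡1 : ∀ n → n C 0 ≡ 1
nC0≡1 n = trans (nCk≡nC[n∸k] {n = n} z≤n) (nCn≡1 n)

alternatingSum : ℕ → ℕ → (ℕ → ℤ) → ℤ
alternatingSum k N f = sumCount 0 N (λ j → sign (k +ℕ j) * + (k C j) * f j)

alternatingSum-pascal : ∀ k N f → alternatingSum (suc k) (suc N) f
                        ≡ alternatingSum k N (f ∘ suc) - alternatingSum k (suc N) f
alternatingSum-pascal k N f = begin
  H 0 + sumCount 1 N H                                ≡⟨ cong (_+_ (H 0)) (sumCount-shift 0 N H) ⟩
  H 0 + sumCount 0 N (H ∘ suc)                        ≡⟨ cong₂ _+_ H0≡-K0 (sumCount-ext 0 N pascal) ⟩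
  - K 0 + sumCount 0 N (λ i → A i - K (suc i))        ≡⟨ cong (_+_ (- K 0)) (sumCount-sub 0 N A (K ∘ suc)) ⟩
  - K 0 + (sumCount 0 N A - sumCount 0 N (K ∘ suc))   ≡⟨ cong (λ t → - K 0 + (sumCount 0 N A - t)) (sumCount-shift 0 N K) ⟨
  - K 0 + (sumCount 0 N A - sumCount 1 N K)           ≡⟨ regroup (K 0) (sumCount 0 N A) (sumCount 1 N K) ⟩
  sumCount 0 N A - (K 0 + sumCount 1 N K)             ∎
  where
  open ≡-Reasoning
  H K A : ℕ → ℤ
  H j = sign (suc k +ℕ j) * + (suc k C j) * f j
  K j = sign (k +ℕ j) * + (k C j) * f j
  A i = sign (k +ℕ i) * + (k C i) * f (suc i)

  H0≡-K0 : H 0 ≡ - K 0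
  H0≡-K0 = begin
    - sign (k +ℕ 0) * + (suc k C 0) * f 0 ≡⟨ cong (λ c → - sign (k +ℕ 0) * + c * f 0) (trans (nC0≡1 (suc k)) (sym (nC0≡1 k))) ⟩
    - sign (k +ℕ 0) * + (k C 0) * f 0     ≡⟨ negate-first (sign (k +ℕ 0)) _ _ ⟩
    - K 0                                 ∎
    where
    negate-first : ∀ s c x → - s * c * x ≡ - (s * c * x)
    negate-first = solve-∀

  pascal : ∀ i → H (suc i) ≡ A i - K (suc i)
  pascal i = begin
    - sign (k +ℕ suc i) * + (suc k C suc i) * f (suc i)
      ≡⟨ cong₂ (λ s c → - s * + c * f (suc i)) sign-step (sym (nCk+nC[k+1]≡[n+1]C[k+1] k i)) ⟩
    - (- s) * + (k C i +ℕ k C suc i) * f (suc i)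
      ≡⟨ cong (λ c → - (- s) * c * f (suc i)) (ℤ.pos-+ (k C i) (k C suc i)) ⟩
    - (- s) * (+ (k C i) + + (k C suc i)) * f (suc i)
      ≡⟨ expand s (+ (k C i)) (+ (k C suc i)) (f (suc i)) ⟩
    s * + (k C i) * f (suc i) - (- s) * + (k C suc i) * f (suc i)
      ≡⟨ cong (λ t → A i - t * + (k C suc i) * f (suc i)) sign-step ⟨
    A i - K (suc i)
      ∎
    where
    s : ℤ
    s = sign (k +ℕ i)
    sign-step : sign (k +ℕ suc i) ≡ - s
    sign-step = cong sign (ℕ.+-suc k i)
    expand : ∀ s a b x → - (- s) * (a + b) * x ≡ s * a * x - (- s) * b * x
    expand = solve-∀

  regroup : ∀ k a s → - k + (a - s) ≡ a - (k + s)
  regroup = solve-∀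

Δ≡alternatingSum : ∀ k N f → k < N → Δ k f ≡ alternatingSum k N f
Δ≡alternatingSum zero (suc N) f _ = begin
  f 0                                            ≡⟨ unit-factors (f 0) ⟩
  1ℤ * 1ℤ * f 0 + 0ℤ                             ≡⟨ cong (_+_ (1ℤ * 1ℤ * f 0)) higher-terms ⟨
  1ℤ * 1ℤ * f 0 + sumCount 1 N (λ j → sign j * + (0 C j) * f j) ∎
  where
  open ≡-Reasoning
  unit-factors : ∀ x → x ≡ 1ℤ * 1ℤ * x + 0ℤ
  unit-factors = solve-∀
  vanish : ∀ s x → s * + 0 * x ≡ 0ℤ
  vanish = solve-∀
  higher-terms : sumCount 1 N (λ j → sign j * + (0 C j) * f j) ≡ 0ℤ
  higher-terms = trans (sumCount-shift 0 N _)
                       (trans (sumCount-ext 0 N (λ j → vanish (sign (suc j)) (f (suc j)))) (sumCount-zero 0 N))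
Δ≡alternatingSum (suc k) (suc N) f (s≤s k<N) = begin
  Δ k (f ∘ suc) - Δ k f
    ≡⟨ cong₂ _-_ (Δ≡alternatingSum k N (f ∘ suc) k<N) (Δ≡alternatingSum k (suc N) f (ℕ.m<n⇒m<1+n k<N)) ⟩
  alternatingSum k N (f ∘ suc) - alternatingSum k (suc N) f
    ≡⟨ alternatingSum-pascal k N f ⟨
  alternatingSum (suc k) (suc N) f ∎
  where open ≡-Reasoning

shift-by-one : ∀ x j → x + + suc j ≡ (x + 1ℤ) + + j
shift-by-one x j = trans (cong (_+_ x) (ℤ.pos-+ 1 j)) (sym (ℤ.+-assoc x 1ℤ (+ j)))

Δ-affine-mul : ∀ k x g → Δ (suc k) (λ j → (x + + j) * g j)
               ≡ x * Δ (suc k) g + + suc k * Δ k (g ∘ suc)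
Δ-affine-mul zero    x g = base x (g 1) (g 0)
  where
  base : ∀ x a b → (x + 1ℤ) * a - (x + + 0) * b ≡ x * (a - b) + 1ℤ * a
  base = solve-∀
Δ-affine-mul (suc k) x g = begin
  Δ (suc k) (λ j → (x + + suc j) * g (suc j)) - Δ (suc k) (λ j → (x + + j) * g j)
    ≡⟨ cong (_- Δ (suc k) (λ j → (x + + j) * g j)) (Δ-ext (suc k) (λ j → cong (_* g (suc j)) (shift-by-one x j))) ⟩
  Δ (suc k) (λ j → (x + 1ℤ + + j) * g (suc j)) - Δ (suc k) (λ j → (x + + j) * g j)
    ≡⟨ cong₂ _-_ (Δ-affine-mul k (x + 1ℤ) (g ∘ suc)) (Δ-affine-mul k x g) ⟩
  ((x + 1ℤ) * Δ (suc k) (g ∘ suc) + + suc k * Δ k (g ∘ suc ∘ suc)) - (x * Δ (suc k) g + + suc k * Δ k (g ∘ suc))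
    ≡⟨ regroup x (+ suc k) (Δ (suc k) g) (Δ k (g ∘ suc ∘ suc)) (Δ k (g ∘ suc)) ⟩
  x * ((Δ k (g ∘ suc ∘ suc) - Δ k (g ∘ suc)) - Δ (suc k) g) + (1ℤ + + suc k) * (Δ k (g ∘ suc ∘ suc) - Δ k (g ∘ suc))
    ∎
  where
  open ≡-Reasoning
  regroup : ∀ x K B P Q → ((x + 1ℤ) * (P - Q) + K * P) - (x * B + K * Q)
                          ≡ x * ((P - Q) - B) + (1ℤ + K) * (P - Q)
  regroup = solve-∀

Δ-pow-step : ∀ k n x → Δ (suc k) (λ j → (x + + j) ^ℤ suc n)
             ≡ x * Δ (suc k) (λ j → (x + + j) ^ℤ n) + + suc k * Δ k (λ j → (x + 1ℤ + + j) ^ℤ n)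
Δ-pow-step k n x =
  trans (Δ-affine-mul k x (λ j → (x + + j) ^ℤ n))
        (cong (λ t → x * Δ (suc k) (λ j → (x + + j) ^ℤ n) + + suc k * t)
              (Δ-ext k (λ j → cong (_^ℤ n) (shift-by-one x j))))

Δ-pow-vanish : ∀ {k} n x → n < k → Δ k (λ j → (x + + j) ^ℤ n) ≡ 0ℤ
Δ-pow-vanish {suc k} zero x _ = Δ-const k 1ℤ
Δ-pow-vanish {suc k} (suc n) x (s≤s n<k) = begin
  Δ (suc k) (λ j → (x + + j) ^ℤ suc n)
    ≡⟨ Δ-pow-step k n x ⟩
  x * Δ (suc k) (λ j → (x + + j) ^ℤ n) + + suc k * Δ k (λ j → (x + 1ℤ + + j) ^ℤ n)
    ≡⟨ cong₂ (λ a b → x * a + + suc k * b) (Δ-pow-vanish n x (ℕ.m<n⇒m<1+n n<k)) (Δ-pow-vanish n (x + 1ℤ) n<k) ⟩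
  x * 0ℤ + + suc k * 0ℤ
    ≡⟨ annihilate x (+ suc k) ⟩
  0ℤ ∎
  where
  open ≡-Reasoning
  annihilate : ∀ x y → x * 0ℤ + y * 0ℤ ≡ 0ℤ
  annihilate = solve-∀

Δ-pow-diagonal : ∀ n x → Δ n (λ j → (x + + j) ^ℤ n) ≡ + (n !)
Δ-pow-diagonal zero    x = refl
Δ-pow-diagonal (suc n) x = begin
  Δ (suc n) (λ j → (x + + j) ^ℤ suc n)
    ≡⟨ Δ-pow-step n n x ⟩
  x * Δ (suc n) (λ j → (x + + j) ^ℤ n) + + suc n * Δ n (λ j → (x + 1ℤ + + j) ^ℤ n)
    ≡⟨ cong₂ (λ a b → x * a + + suc n * b) (Δ-pow-vanish n x (ℕ.n<1+n n)) (Δ-pow-diagonal n (x + 1ℤ)) ⟩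
  x * 0ℤ + + suc n * + (n !)
    ≡⟨ trans (cong (_+ + suc n * + (n !)) (ℤ.*-zeroʳ x)) (ℤ.+-identityˡ _) ⟩
  + suc n * + (n !)
    ≡⟨ ℤ.pos-* (suc n) (n !) ⟨
  + (suc n !) ∎
  where open ≡-Reasoning

pos-^ : ∀ a k → (+ a) ^ℤ k ≡ + (a ^ k)
pos-^ a zero    = refl
pos-^ a (suc k) = trans (cong (_*_ (+ a)) (pos-^ a k)) (sym (ℤ.pos-* a (a ^ k)))

sign*-1^≡1 : ∀ k → sign k * -1ℤ ^ℤ k ≡ 1ℤ
sign*-1^≡1 zero    = refl
sign*-1^≡1 (suc k) = trans (cancel-signs (sign k) (-1ℤ ^ℤ k)) (sign*-1^≡1 k)
  where
  cancel-signs : ∀ s p → - s * (-1ℤ * p) ≡ s * p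
  cancel-signs = solve-∀

proposition2p3 : (n : ℕ) → let m = suc n in
    sumCount 1 (m ∸ 1) (λ α → sign (m +ℕ α +ℕ 1) * + (m C (α +ℕ 1)) * + (α ^ m))
      ≡ + (m !) - + 1
proposition2p3 n = begin
  sumCount 1 n (λ α → sign (m +ℕ α +ℕ 1) * + (m C (α +ℕ 1)) * + (α ^ m))
    ≡⟨ sumCount-ext 1 n reindex ⟩
  sumCount 1 n (G ∘ suc)
    ≡⟨ sumCount-shift 1 n G ⟨
  sumCount 2 n G
    ≡⟨ add-and-subtract-one (sumCount 2 n G) ⟩
  (1ℤ + (0ℤ + sumCount 2 n G)) - 1ℤ
    ≡⟨ cong₂ (λ a b → (a + (b + sumCount 2 n G)) - 1ℤ) G0≡1 G1≡0 ⟨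
  alternatingSum m (suc m) f - 1ℤ
    ≡⟨ cong (_- 1ℤ) (Δ≡alternatingSum m (suc m) f (ℕ.n<1+n m)) ⟨
  Δ m f - 1ℤ
    ≡⟨ cong (_- 1ℤ) (Δ-pow-diagonal m -1ℤ) ⟩
  + (m !) - 1ℤ ∎
  where
  open ≡-Reasoning
  m : ℕ
  m = suc n
  f G : ℕ → ℤ
  f j = (-1ℤ + + j) ^ℤ m
  G j = sign (m +ℕ j) * + (m C j) * f j

  G0≡1 : G 0 ≡ 1ℤ
  G0≡1 = begin
    sign (m +ℕ 0) * + (m C 0) * -1ℤ ^ℤ m ≡⟨ cong₂ (λ k c → sign k * + c * -1ℤ ^ℤ m) (ℕ.+-identityʳ m) (nC0≡1 m) ⟩
    sign m * 1ℤ * -1ℤ ^ℤ m               ≡⟨ cong (_* -1ℤ ^ℤ m) (ℤ.*-identityʳ (sign m)) ⟩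
    sign m * -1ℤ ^ℤ m                    ≡⟨ sign*-1^≡1 m ⟩
    1ℤ                                   ∎

  G1≡0 : G 1 ≡ 0ℤ
  G1≡0 = ℤ.*-zeroʳ (sign (m +ℕ 1) * + (m C 1))

  -- f (suc α) is (+ α) ^ℤ m by computation: -1ℤ + + suc α reduces to + α.
  reindex : ∀ α → sign (m +ℕ α +ℕ 1) * + (m C (α +ℕ 1)) * + (α ^ m) ≡ G (suc α)
  reindex α = cong₂ _*_ (cong₂ (λ k c → sign k * + (m C c)) m+α+1≡m+suc-α (ℕ.+-comm α 1))
                        (sym (pos-^ α m))
    where
    m+α+1≡m+suc-α : m +ℕ α +ℕ 1 ≡ m +ℕ suc α
    m+α+1≡m+suc-α = trans (ℕ.+-assoc m α 1) (cong (_+ℕ_ m) (ℕ.+-comm α 1))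

  add-and-subtract-one : ∀ s → s ≡ (1ℤ + (0ℤ + s)) - 1ℤ
  add-and-subtract-one = solve-∀
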